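{- Let $n\geq r\geq 3$ and $t\geq 3$ be integers, let $H$ be a connected Berge-$K_{3,t}$-free linear $r$-graph with $n$ vertices, and let $u,w\in V(H)$ be adjacent vertices. Then: (i) for every $v\in N_1(u,w)$, $\sum_{i=2}^{r}e^i_v(N_{uw})\leq t(r-1)+1$; (ii) for every $v\in N_2(u,w)$, $\sum_{i=1}^{r-1}e^i_v(N_{uw})\leq t(r-1)$; (iii) for every $v\in l_{uw}\setminus\{u,w\}$, $\sum_{i=2}^{r}e^i_v(N_{uw})\leq (t-1)(r-1)+1$.
   Context: An $r$-graph $H$ has edges that are $r$-element subsets of $V(H)$; it is linear if any two distinct edges share at most one vertex. For a simple graph $F$, $H$ is Berge-$F$-free if no subset $E'\subseteq E(H)$ admits a bijection $\phi:E(F)\to E'$ with $e\subseteq\phi(e)$ for all $e\in E(F)$; $K_{3,t}$ is the complete bipartite graph with parts of sizes $3$ and $t$. Two vertices are adjacent if some edge contains both; $N_x(H)$ is the set of vertices adjacent to $x$, and $N_{uw}=N_u(H)\cap N_w(H)$. For adjacent $u,w$, $l_{uw}$ is the unique edge containing both. $N_1(u,w)=\{v: v\in N_{uw},\ v\notin l_{uw}\}$ and $N_2(u,w)=N_u(H)\setminus(N_w(H)\cup\{w\})$. For $U\subseteq V(H)$ and a vertex $v$, $E^k_v(U)=\{e\in E(H): v\in e,\ |e\cap U|=k\}$ and $e^k_v(U)=|E^k_v(U)|$. -}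

module Defs where

open import Data.Nat using (ℕ; zero; suc; _+_; _∸_; _≤_; _≡ᵇ_)
open import Data.Bool using (Bool; true; false; _∧_; not; if_then_else_)
open import Data.Fin using (Fin; _≟_)
open import Data.Fin.Subset using (Subset; _∈_; _∉_; _∩_; ∣_∣)
open import Data.Vec using (lookup; tabulate)
open import Data.List using (List; []; _∷_; length; map; upTo)
open import Data.Nat.ListAction using (sum)
open import Data.Bool.ListAction using (any)
import Data.List as L
open import Data.Product using (Σ; _×_; _,_)
open import Data.Sum using (_⊎_; inj₁; inj₂)
open import Relation.Nullary using (¬_; does)
open import Relation.Binary.PropositionalEquality using (_≡_; _≢_)
open import Function.Definitions using (Injective)

-- A hypergraph on vertex set Fin n is given by its list of edges E.
-- Edges are subsets of Fin n; the list has no repeated edges (it is a set).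

Edge : ℕ → Set
Edge n = Subset n

module _ {n : ℕ} (E : List (Edge n)) where

  EIdx : Set
  EIdx = Fin (length E)

  edge : EIdx → Edge n
  edge i = L.lookup E i

  IsRGraph : ℕ → Set
  IsRGraph r = Injective _≡_ _≡_ edge × (∀ i → ∣ edge i ∣ ≡ r)

  Linear : Set
  Linear = ∀ i j → i ≢ j → ∣ edge i ∩ edge j ∣ ≤ 1

  adjᵇ : Fin n → Fin n → Bool
  adjᵇ x y = not (does (x ≟ y)) ∧ any (λ e → lookup e x ∧ lookup e y) E

  Adjacent : Fin n → Fin n → Set
  Adjacent x y = adjᵇ x y ≡ true

  Nbhd : Fin n → Subset n
  Nbhd x = tabulate (adjᵇ x)

  Ncommon : Fin n → Fin n → Subset n
  Ncommon u w = Nbhd u ∩ Nbhd w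

  -- v lies in l_{uw} (the edge containing u and w; unique by linearity)
  InL : Fin n → Fin n → Fin n → Set
  InL u w v = Σ EIdx λ i → u ∈ edge i × w ∈ edge i × v ∈ edge i

  InN1 : Fin n → Fin n → Fin n → Set
  InN1 u w v = v ∈ Ncommon u w × ¬ InL u w v

  InN2 : Fin n → Fin n → Fin n → Set
  InN2 u w v = v ∈ Nbhd u × v ∉ Nbhd w × v ≢ w

  eCount : ℕ → Fin n → Subset n → ℕ
  eCount k v U = go E
    where
    go : List (Edge n) → ℕ
    go [] = 0
    go (e ∷ es) = (if lookup e v ∧ (∣ e ∩ U ∣ ≡ᵇ k) then 1 else 0) + go es

  data Reach : Fin n → Fin n → Set where
    here : ∀ {x} → Reach x x
    step : ∀ {x y z} → Adjacent x y → Reach y z → Reach x z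

  Connected : Set
  Connected = ∀ x y → Reach x y

  BergeK3t : ℕ → Set
  BergeK3t t =
    Σ (Fin 3 ⊎ Fin t → Fin n) λ f →
    Σ (Fin 3 × Fin t → EIdx) λ φ →
      Injective _≡_ _≡_ f × Injective _≡_ _≡_ φ ×
      (∀ a b → f (inj₁ a) ∈ edge (φ (a , b)) × f (inj₂ b) ∈ edge (φ (a , b)))

  BergeK3tFree : ℕ → Set
  BergeK3tFree t = ¬ BergeK3t t

sumRange : ℕ → ℕ → (ℕ → ℕ) → ℕ
sumRange lo hi f = sum (map (λ i → f (lo + i)) (upTo (suc hi ∸ lo)))

-- Fix v and call an edge through v relevant if it contains a common neighbour x ≠ v of u
-- and w; every edge counted by the sums is relevant (it meets N_uw twice, or once when
-- v ∉ N_uw), and by linearity distinct relevant edges have distinct chosen vertices x.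
-- The relevant edges meeting {u, w} are at most two (at most one if v ∈ l_uw); those whose
-- x lies on l_uw are at most r − 2, since these x are distinct vertices of l_uw other than
-- u and w (none at all if v ∈ l_uw). Each remaining relevant edge e gives an edge between
-- the edge through u and x and the edge through w and x, in a bipartite graph of maximum
-- degree r − 1. If there were more than (t − 1)(r − 1) of them, König's theorem (some
-- vertex cover is no larger than some matching) would give a matching of size t, and the
-- t matched edges e together with their two partners form a Berge-K₃,ₜ with parts
-- {u, w, v} and the t chosen vertices x.

module Submission where

open import Defs
open import Data.Nat using (ℕ; zero; suc; _+_; _*_; _∸_; _≤_; _<_; z≤n; s≤s; _≡ᵇ_; _≤?_; _<?_)
open import Data.Nat.Properties
open import Data.Nat.ListAction using (sum)
open import Data.Bool using (true; false; _∧_; if_then_else_; T)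
open import Data.Bool.Properties using (T-≡; T-∧)
open import Data.Fin using (Fin; zero; suc; inject≤)
import Data.Fin as Fin
import Data.Fin.Properties as Fin
open import Data.Fin.Patterns using (0F; 1F; 2F)
open import Data.Fin.Subset using (Subset; _∈_; _∉_; _∩_; ∣_∣; ⁅_⁆; ⊥; _-_; _⊆_)
open import Data.Fin.Subset.Properties using (_∈?_; x∈p∩q⁺; x∈p∩q⁻; p⊆q⇒∣p∣≤∣q∣; ∣⁅x⁆∣≡1; x∈⁅x⁆; x∈⁅y⁆⇒x≡y; ∣⊥∣≡0; x∈p∧x≢y⇒x∈p-y; x∈p⇒∣p-x∣<∣p∣)
open import Data.Vec using (lookup)
open import Data.Vec.Properties using ([]=⇒lookup; lookup⇒[]=; lookup∘tabulate)
open import Data.List using (List; []; _∷_; _++_; length; map; filter; upTo; allFin)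
import Data.List as List
open import Data.List.Properties using (length-filter; filter-notAll; filter-none; filter-accept; filter-reject; length-map; length-++; map-∘; map-tabulate; tabulate-lookup)
open import Data.List.Relation.Unary.All as All using (All; []; _∷_)
import Data.List.Relation.Unary.All.Properties as All
open import Data.List.Relation.Unary.Any as Any using (Any; here; there)
open import Data.List.Relation.Unary.Any.Properties using (any⁺; any⁻; lookup-index)
open import Data.List.Relation.Unary.Unique.Propositional using (Unique)
open import Data.List.Relation.Unary.AllPairs using ([]; _∷_)
import Data.List.Relation.Unary.Unique.Propositional.Properties as Unique
open import Data.List.Membership.Propositional using (find; lose) renaming (_∈_ to _∈ₗ_; _∉_ to _∉ₗ_)
import Data.List.Membership.DecPropositional as DecMembership
open import Data.List.Membership.Propositional.Properties using (∈-filter⁺; ∈-filter⁻; ∈-map⁺; ∈-map⁻; ∈-lookup)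
open import Data.List.Relation.Binary.Subset.Propositional using () renaming (_⊆_ to _⊆ₗ_)
open import Data.List.Relation.Binary.Disjoint.Propositional using (Disjoint)
open import Data.Product using (∃; _×_; _,_; proj₁; proj₂)
import Data.Product as Product
import Data.Product.Properties as Product
open import Data.Sum using (_⊎_; inj₁; inj₂; [_,_])
import Data.Sum as Sum
import Data.Sum.Properties as Sum
open import Data.Empty using (⊥-elim)
open import Function using (_∘_; id; Equivalence)
open import Function.Definitions using (Injective)
open import Relation.Nullary using (¬_; Dec; yes; no; ¬?; _×-dec_; _⊎-dec_; contradiction)
open import Relation.Unary using (Decidable)
open import Relation.Binary.Definitions using (DecidableEquality)
open import Relation.Binary.PropositionalEquality using (_≡_; _≢_; refl; sym; trans; cong; subst; subst₂)
open import Algebra.Properties.CommutativeSemigroup +-commutativeSemigroup using (interchange)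

module _ {A : Set} where

  length-filter-filter : {P Q : A → Set} (P? : Decidable P) (Q? : Decidable Q) (xs : List A) →
    length (filter P? (filter Q? xs)) ≤ length (filter P? xs)
  length-filter-filter P? Q? [] = z≤n
  length-filter-filter P? Q? (x ∷ xs) with Q? x
  ... | yes _ with P? x
  ...   | yes _ = s≤s (length-filter-filter P? Q? xs)
  ...   | no _  = length-filter-filter P? Q? xs
  length-filter-filter P? Q? (x ∷ xs) | no _ with P? x
  ...   | yes _ = m≤n⇒m≤1+n (length-filter-filter P? Q? xs)
  ...   | no _  = length-filter-filter P? Q? xs

  length-filter-∁ : {P : A → Set} (P? : Decidable P) (xs : List A) →
    length xs ≡ length (filter P? xs) + length (filter (¬? ∘ P?) xs)
  length-filter-∁ P? [] = refl
  length-filter-∁ P? (x ∷ xs) with P? x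
  ... | yes _ = cong suc (length-filter-∁ P? xs)
  ... | no _  = trans (cong suc (length-filter-∁ P? xs)) (sym (+-suc _ _))

  filter-∁-< : {x : A} {xs : List A} {P : A → Set} (P? : Decidable P) → x ∈ₗ xs → P x →
    length (filter (¬? ∘ P?) xs) < length xs
  filter-∁-< P? x∈xs px = filter-notAll (¬? ∘ P?) _ (Any.map (λ { refl ¬px → ¬px px }) x∈xs)

  ⊆-map⁻ : {B : Set} (f : A → B) (xs : List A) {ys : List B} → ys ⊆ₗ map f xs →
    ∃ λ zs → zs ⊆ₗ xs × map f zs ≡ ys
  ⊆-map⁻ f xs {[]} _ = [] , (λ ()) , refl
  ⊆-map⁻ f xs {y ∷ ys} sub with ∈-map⁻ f (sub (here refl)) | ⊆-map⁻ f xs (sub ∘ there)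
  ... | z , z∈xs , refl | zs , zs⊆xs , refl = z ∷ zs , (λ { (here refl) → z∈xs ; (there m) → zs⊆xs m }) , refl

  Unique[map]⇒injectiveOn : {B : Set} (f : A → B) {xs : List A} → Unique (map f xs) →
    ∀ {x y} → x ∈ₗ xs → y ∈ₗ xs → f x ≡ f y → x ≡ y
  Unique[map]⇒injectiveOn f {_ ∷ _} _ (here refl) (here refl) _ = refl
  Unique[map]⇒injectiveOn f {_ ∷ _} (fx∉ ∷ _) (here refl) (there y∈) eq = ⊥-elim (All.lookup fx∉ (∈-map⁺ f y∈) eq)
  Unique[map]⇒injectiveOn f {_ ∷ _} (fy∉ ∷ _) (there x∈) (here refl) eq = ⊥-elim (All.lookup fy∉ (∈-map⁺ f x∈) (sym eq))
  Unique[map]⇒injectiveOn f {_ ∷ _} (_ ∷ u) (there x∈) (there y∈) eq = Unique[map]⇒injectiveOn f u x∈ y∈ eq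

  length-filter-map : {B : Set} {P : B → Set} (P? : Decidable P) (f : A → B) (xs : List A) →
    length (filter P? (map f xs)) ≡ length (filter (P? ∘ f) xs)
  length-filter-map P? f [] = refl
  length-filter-map P? f (x ∷ xs) with P? (f x)
  ... | yes _ = cong suc (length-filter-map P? f xs)
  ... | no _  = length-filter-map P? f xs

  length-filter-mono : {P Q : A → Set} (P? : Decidable P) (Q? : Decidable Q) →
    (∀ {x} → P x → Q x) → ∀ xs → length (filter P? xs) ≤ length (filter Q? xs)
  length-filter-mono P? Q? P⇒Q [] = z≤n
  length-filter-mono P? Q? P⇒Q (x ∷ xs) with P? x | Q? x
  ... | yes _  | yes _  = s≤s (length-filter-mono P? Q? P⇒Q xs)
  ... | yes px | no ¬qx = ⊥-elim (¬qx (P⇒Q px))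
  ... | no _   | yes _  = m≤n⇒m≤1+n (length-filter-mono P? Q? P⇒Q xs)
  ... | no _   | no _   = length-filter-mono P? Q? P⇒Q xs

  length-filter-⊎ : {P Q : A → Set} (P? : Decidable P) (Q? : Decidable Q) (xs : List A) →
    length (filter (λ x → P? x ⊎-dec Q? x) xs) ≤ length (filter P? xs) + length (filter Q? xs)
  length-filter-⊎ P? Q? [] = z≤n
  length-filter-⊎ P? Q? (x ∷ xs) with P? x | Q? x
  ... | yes _ | yes _ = s≤s (≤-trans (length-filter-⊎ P? Q? xs) (+-monoʳ-≤ _ (n≤1+n _)))
  ... | yes _ | no _  = s≤s (length-filter-⊎ P? Q? xs)
  ... | no _  | yes _ = ≤-trans (s≤s (length-filter-⊎ P? Q? xs)) (≤-reflexive (sym (+-suc _ _)))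
  ... | no _  | no _  = length-filter-⊎ P? Q? xs

  Unique∧allEqual⇒length≤1 : (xs : List A) → Unique xs → (∀ {x y} → x ∈ₗ xs → y ∈ₗ xs → x ≡ y) → length xs ≤ 1
  Unique∧allEqual⇒length≤1 [] _ _ = z≤n
  Unique∧allEqual⇒length≤1 (_ ∷ []) _ _ = s≤s z≤n
  Unique∧allEqual⇒length≤1 (_ ∷ _ ∷ _) ((x≢y ∷ _) ∷ _) all≡ = ⊥-elim (x≢y (all≡ (here refl) (there (here refl))))

  injectiveOn⇒Unique[map] : {B : Set} (f : A → B) {xs : List A} → Unique xs →
    (∀ {x y} → x ∈ₗ xs → y ∈ₗ xs → f x ≡ f y → x ≡ y) → Unique (map f xs)
  injectiveOn⇒Unique[map] f {[]} [] _ = []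
  injectiveOn⇒Unique[map] f {x ∷ xs} (x∉ ∷ u) inj =
    All.tabulate fx∉ ∷ injectiveOn⇒Unique[map] f u (λ x∈ y∈ → inj (there x∈) (there y∈))
    where
    fx∉ : ∀ {z} → z ∈ₗ map f xs → f x ≢ z
    fx∉ z∈ fx≡z with ∈-map⁻ f z∈
    ... | y , y∈xs , refl = All.lookup x∉ y∈xs (inj (here refl) (there y∈xs) fx≡z)

[,]-injective : {A B C : Set} {f : A → C} {g : B → C} → Injective _≡_ _≡_ f → Injective _≡_ _≡_ g →
  (∀ a b → f a ≢ g b) → Injective _≡_ _≡_ [ f , g ]
[,]-injective f-inj g-inj f≢g {inj₁ _} {inj₁ _} eq = cong inj₁ (f-inj eq)
[,]-injective f-inj g-inj f≢g {inj₁ a} {inj₂ b} eq = ⊥-elim (f≢g a b eq)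
[,]-injective f-inj g-inj f≢g {inj₂ b} {inj₁ a} eq = ⊥-elim (f≢g a b (sym eq))
[,]-injective f-inj g-inj f≢g {inj₂ _} {inj₂ _} eq = cong inj₂ (g-inj eq)

module _ {m : ℕ} {P : Fin m → Set} (P? : Decidable P) where

  witnessOr : Fin m → Fin m
  witnessOr d with Fin.any? P?
  ... | yes (x , _) = x
  ... | no _        = d

  witnessOr-satisfies : ∀ d → ∃ P → P (witnessOr d)
  witnessOr-satisfies d ∃P with Fin.any? P?
  ... | yes (_ , px) = px
  ... | no ¬∃P       = ⊥-elim (¬∃P ∃P)

-- Graphs with parts A and B are lists of pairs; repeated edges are allowed.
module Bipartite {A B : Set} (_≟ᴬ_ : DecidableEquality A) (_≟ᴮ_ : DecidableEquality B) where

  Vertex : Set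
  Vertex = A ⊎ B

  _≟ᵛ_ : DecidableEquality Vertex
  _≟ᵛ_ = Sum.≡-dec _≟ᴬ_ _≟ᴮ_

  open DecMembership _≟ᵛ_ using () renaming (_∈?_ to _∈ₗ?_)

  Incident : Vertex → A × B → Set
  Incident (inj₁ x) e = proj₁ e ≡ x
  Incident (inj₂ y) e = proj₂ e ≡ y

  incident? : ∀ z → Decidable (Incident z)
  incident? (inj₁ x) e = proj₁ e ≟ᴬ x
  incident? (inj₂ y) e = proj₂ e ≟ᴮ y

  degree : Vertex → List (A × B) → ℕ
  degree z G = length (filter (incident? z) G)

  ends : List (A × B) → List Vertex
  ends [] = []
  ends ((a , b) ∷ M) = inj₁ a ∷ inj₂ b ∷ ends M

  IsMatching : List (A × B) → Set
  IsMatching M = Unique (ends M)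

  Covers : List Vertex → A × B → Set
  Covers W e = Any (λ z → Incident z e) W

  ends⁺ : ∀ {z e} M → e ∈ₗ M → Incident z e → z ∈ₗ ends M
  ends⁺ {inj₁ _} (_ ∷ _) (here refl) refl = here refl
  ends⁺ {inj₂ _} (_ ∷ _) (here refl) refl = there (here refl)
  ends⁺ (_ ∷ M) (there e∈M) i = there (there (ends⁺ M e∈M i))

  ends⁻ : ∀ {z} M → z ∈ₗ ends M → ∃ λ e → e ∈ₗ M × Incident z e
  ends⁻ (e ∷ M) (here refl) = e , here refl , refl
  ends⁻ (e ∷ M) (there (here refl)) = e , here refl , refl
  ends⁻ (e ∷ M) (there (there z∈)) with ends⁻ M z∈
  ... | e′ , e′∈M , i = e′ , there e′∈M , i

  endpoint∉rest : ∀ {a b z} M → IsMatching ((a , b) ∷ M) → Incident z (a , b) → z ∉ₗ ends M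
  endpoint∉rest {z = inj₁ _} M (a∉ ∷ _) refl z∈M = All.lookup a∉ (there z∈M) refl
  endpoint∉rest {z = inj₂ _} M (_ ∷ b∉ ∷ _) refl z∈M = All.lookup b∉ z∈M refl

  matching-incident-unique : ∀ {z e e′} M → IsMatching M → e ∈ₗ M → e′ ∈ₗ M →
    Incident z e → Incident z e′ → e ≡ e′
  matching-incident-unique (_ ∷ M) _ (here refl) (here refl) _ _ = refl
  matching-incident-unique (_ ∷ M) u (here refl) (there e′∈M) i i′ =
    ⊥-elim (endpoint∉rest M u i (ends⁺ M e′∈M i′))
  matching-incident-unique (_ ∷ M) u (there e∈M) (here refl) i i′ =
    ⊥-elim (endpoint∉rest M u i′ (ends⁺ M e∈M i))
  matching-incident-unique (_ ∷ M) (_ ∷ _ ∷ u) (there e∈M) (there e′∈M) i i′ =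
    matching-incident-unique M u e∈M e′∈M i i′

  matching-lookup-injective : ∀ {z} M → IsMatching M → (i j : Fin (length M)) →
    Incident z (List.lookup M i) → Incident z (List.lookup M j) → i ≡ j
  matching-lookup-injective (_ ∷ M) _ zero zero _ _ = refl
  matching-lookup-injective (_ ∷ M) u zero (suc j) i i′ =
    ⊥-elim (endpoint∉rest M u i (ends⁺ M (∈-lookup j) i′))
  matching-lookup-injective (_ ∷ M) u (suc i) zero i′ i″ =
    ⊥-elim (endpoint∉rest M u i″ (ends⁺ M (∈-lookup i) i′))
  matching-lookup-injective (_ ∷ M) (_ ∷ _ ∷ u) (suc i) (suc j) p q =
    cong suc (matching-lookup-injective M u i j p q)

  _∖_ : List Vertex → Vertex → List Vertex
  W ∖ z = filter (¬? ∘ (_≟ᵛ z)) W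

  covers-∖ : ∀ {W z} M → z ∉ₗ ends M → All (Covers W) M → All (Covers (W ∖ z)) M
  covers-∖ {W} {z} M z∉M covered = All.tabulate λ {e} e∈M → avoid e∈M (find (All.lookup covered e∈M))
    where
    avoid : ∀ {e} → e ∈ₗ M → ∃ (λ y → y ∈ₗ W × Incident y e) → Covers (W ∖ z) e
    avoid e∈M (y , y∈W , i) = lose (∈-filter⁺ (¬? ∘ (_≟ᵛ z)) y∈W λ { refl → z∉M (ends⁺ M e∈M i) }) i

  matching≤cover : ∀ M W → IsMatching M → All (Covers W) M → length M ≤ length W
  matching≤cover [] W _ _ = z≤n
  matching≤cover ((a , b) ∷ M) W u@(_ ∷ _ ∷ u′) (c ∷ cs) with find c
  ... | z , z∈W , i = ≤-<-trans (matching≤cover M (W ∖ z) u′ (covers-∖ M (endpoint∉rest M u i) cs))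
                                (filter-∁-< (_≟ᵛ z) z∈W refl)

  matching<cover : ∀ {z} M W → IsMatching M → All (Covers W) M → z ∉ₗ ends M → z ∈ₗ W →
    length M < length W
  matching<cover {z} M W u covered z∉M z∈W =
    ≤-<-trans (matching≤cover M (W ∖ z) u (covers-∖ M z∉M covered)) (filter-∁-< (_≟ᵛ z) z∈W refl)

  edges≤cover*degree : ∀ {Δ} W G → All (Covers W) G → (∀ z → degree z G ≤ Δ) →
    length G ≤ length W * Δ
  edges≤cover*degree [] [] _ _ = z≤n
  edges≤cover*degree [] (_ ∷ _) (() ∷ _) _
  edges≤cover*degree {Δ} (w ∷ W) G covered deg = begin
    length G                                         ≡⟨ length-filter-∁ (incident? w) G ⟩
    degree w G + length G∖w                          ≤⟨ +-mono-≤ (deg w) (edges≤cover*degree W G∖w covered′ deg′) ⟩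
    Δ + length W * Δ                                 ∎
    where
    open ≤-Reasoning
    G∖w : List (A × B)
    G∖w = filter (¬? ∘ incident? w) G
    covered′ : All (Covers W) G∖w
    covered′ = All.tabulate λ e∈ → covered-off-w (∈-filter⁻ (¬? ∘ incident? w) e∈)
      where
      covered-off-w : ∀ {e} → e ∈ₗ G × ¬ Incident w e → Covers W e
      covered-off-w (e∈G , ¬i) with All.lookup covered e∈G
      ... | here i = ⊥-elim (¬i i)
      ... | there c = c
    deg′ : ∀ z → degree z G∖w ≤ Δ
    deg′ z = ≤-trans (length-filter-filter (incident? z) (¬? ∘ incident? w) G) (deg z)

  record CoverMatching (G : List (A × B)) : Set where
    field
      cover          : List Vertex
      matching       : List (A × B)
      covers         : All (Covers cover) G
      matching⊆G     : matching ⊆ₗ G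
      isMatching     : IsMatching matching
      cover≤matching : length cover ≤ length matching

  _≟ᵉ_ : DecidableEquality (A × B)
  _≟ᵉ_ = Product.≡-dec _≟ᴬ_ _≟ᴮ_

  -- Let (W₁ , M₁) be a
  -- certificate for the edges not at b. If a is free in M₁, add (a , b) to M₁ and b to W₁.
  -- If M₁ matches a by (a , c) and a has yet another edge f, argue as Rizzi does with the
  -- certificate for G minus f. Otherwise delete a and merge c into b.
  module KonigStep (a : A) (b : B) (G′ : List (A × B))
                   (ih : ∀ H → length H ≤ length G′ → CoverMatching H) where

    G : List (A × B)
    G = (a , b) ∷ G′

    G′∖b : List (A × B)
    G′∖b = filter (¬? ∘ incident? (inj₂ b)) G′

    open CoverMatching (ih G′∖b (length-filter _ G′)) renaming
      (cover to W₁; matching to M₁; covers to covers₁; matching⊆G to M₁⊆;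
       isMatching to M₁-matching; cover≤matching to W₁≤M₁)

    M₁⊆G′ : M₁ ⊆ₗ G′
    M₁⊆G′ = proj₁ ∘ ∈-filter⁻ _ ∘ M₁⊆

    b∉M₁ : inj₂ b ∉ₗ ends M₁
    b∉M₁ b∈M₁ with ends⁻ M₁ b∈M₁
    ... | e , e∈M₁ , i = proj₂ (∈-filter⁻ (¬? ∘ incident? (inj₂ b)) {xs = G′} (M₁⊆ e∈M₁)) i

    covers-b∷W₁ : All (Covers (inj₂ b ∷ W₁)) G
    covers-b∷W₁ = here refl ∷ All.tabulate cover-at-b
      where
      cover-at-b : ∀ {e} → e ∈ₗ G′ → Covers (inj₂ b ∷ W₁) e
      cover-at-b {e} e∈G′ with incident? (inj₂ b) e
      ... | yes i = here i
      ... | no ¬i = there (All.lookup covers₁ (∈-filter⁺ _ e∈G′ ¬i))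

    a-unmatched : inj₁ a ∉ₗ ends M₁ → CoverMatching G
    a-unmatched a∉M₁ = record
      { cover          = inj₂ b ∷ W₁
      ; matching       = (a , b) ∷ M₁
      ; covers         = covers-b∷W₁
      ; matching⊆G     = λ { (here refl) → here refl ; (there e∈M₁) → there (M₁⊆G′ e∈M₁) }
      ; isMatching     = ((λ ()) ∷ All.¬Any⇒All¬ _ a∉M₁) ∷ All.¬Any⇒All¬ _ b∉M₁ ∷ M₁-matching
      ; cover≤matching = s≤s W₁≤M₁
      }

    module SecondEdgeAtA (ea : A × B) (ea∈M₁ : ea ∈ₗ M₁) (a-ea : Incident (inj₁ a) ea)
                         (f : A × B) (f∈G′ : f ∈ₗ G′) (a-f : Incident (inj₁ a) f) (f≢ea : f ≢ ea) where

      H : List (A × B)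
      H = (a , b) ∷ filter (¬? ∘ (_≟ᵉ f)) G′

      H⊆G : H ⊆ₗ G
      H⊆G (here refl) = here refl
      H⊆G (there e∈) = there (proj₁ (∈-filter⁻ _ e∈))

      open CoverMatching (ih H (filter-∁-< (_≟ᵉ f) f∈G′ refl)) renaming
        (cover to W₂; matching to M₂; covers to covers₂; matching⊆G to M₂⊆H;
         isMatching to M₂-matching; cover≤matching to W₂≤M₂)

      M₁⊆H : M₁ ⊆ₗ H
      M₁⊆H {e} e∈M₁ = there (∈-filter⁺ (¬? ∘ (_≟ᵉ f)) (M₁⊆G′ e∈M₁) λ { refl →
        f≢ea (matching-incident-unique {inj₁ a} M₁ M₁-matching e∈M₁ ea∈M₁ a-f a-ea) })

      -- If M₂ is no larger than M₁, then b cannot be in W₂ (W₂ covers M₁, which misses b),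
      -- so W₂ covers (a , b) through a, and hence also covers f.
      M₂≤M₁-case : ¬ length M₁ < length M₂ → CoverMatching G
      M₂≤M₁-case M₁≮M₂ = record
        { cover = W₂ ; matching = M₂ ; covers = All.head covers₂ ∷ All.tabulate covers-G′
        ; matching⊆G = H⊆G ∘ M₂⊆H ; isMatching = M₂-matching ; cover≤matching = W₂≤M₂ }
        where
        b∉W₂ : inj₂ b ∉ₗ W₂
        b∉W₂ b∈W₂ = M₁≮M₂ (<-≤-trans
          (matching<cover M₁ W₂ M₁-matching (All.tabulate (All.lookup covers₂ ∘ M₁⊆H)) b∉M₁ b∈W₂)
          W₂≤M₂)

        a∈W₂ : inj₁ a ∈ₗ W₂
        a∈W₂ with find (All.head covers₂)
        ... | inj₁ _ , z∈W₂ , refl = z∈W₂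
        ... | inj₂ _ , z∈W₂ , refl = ⊥-elim (b∉W₂ z∈W₂)

        covers-G′ : ∀ {e} → e ∈ₗ G′ → Covers W₂ e
        covers-G′ {e} e∈G′ with e ≟ᵉ f
        ... | yes refl = lose a∈W₂ a-f
        ... | no e≢f = All.lookup covers₂ (there (∈-filter⁺ _ e∈G′ e≢f))

      result : CoverMatching G
      result with length M₁ <? length M₂
      ... | no M₁≮M₂ = M₂≤M₁-case M₁≮M₂
      ... | yes M₁<M₂ = record
        { cover = inj₂ b ∷ W₁ ; matching = M₂ ; covers = covers-b∷W₁
        ; matching⊆G = H⊆G ∘ M₂⊆H ; isMatching = M₂-matching
        ; cover≤matching = ≤-trans (s≤s W₁≤M₁) M₁<M₂ }

    module OnlyEdgeAtA (c : B) (ac∈M₁ : (a , c) ∈ₗ M₁)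
                       (only : ∀ {e} → e ∈ₗ G′ → Incident (inj₁ a) e → e ≡ (a , c)) where

      c≢b : c ≢ b
      c≢b c≡b = b∉M₁ (ends⁺ M₁ ac∈M₁ c≡b)

      ac∈G′ : (a , c) ∈ₗ G′
      ac∈G′ = M₁⊆G′ ac∈M₁

      merge : B → B
      merge y with y ≟ᴮ c
      ... | yes _ = b
      ... | no _  = y

      merge-c : merge c ≡ b
      merge-c with c ≟ᴮ c
      ... | yes _   = refl
      ... | no c≢c = ⊥-elim (c≢c refl)

      merge-≢c : ∀ {y} → y ≢ c → merge y ≡ y
      merge-≢c {y} y≢c with y ≟ᴮ c
      ... | yes y≡c = ⊥-elim (y≢c y≡c)
      ... | no _    = refl

      contract : A × B → A × B
      contract = Product.map₂ merge

      ends-contract : ∀ X → ends (map contract X) ≡ map (Sum.map₂ merge) (ends X)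
      ends-contract [] = refl
      ends-contract ((x , y) ∷ X) = cong (λ zs → inj₁ x ∷ inj₂ (merge y) ∷ zs) (ends-contract X)

      L : List (A × B)
      L = filter (¬? ∘ incident? (inj₁ a)) G′

      L⊆G′ : L ⊆ₗ G′
      L⊆G′ = proj₁ ∘ ∈-filter⁻ (¬? ∘ incident? (inj₁ a)) {xs = G′}

      open CoverMatching (ih (map contract L) (≤-trans (≤-reflexive (length-map contract L))
                               (<⇒≤ (filter-∁-< (incident? (inj₁ a)) ac∈G′ refl)))) renaming
        (cover to W′; matching to M′; covers to covers′; matching⊆G to M′⊆;
         isMatching to M′-matching; cover≤matching to W′≤M′)

      lifted : ∃ λ X → X ⊆ₗ L × map contract X ≡ M′
      lifted = ⊆-map⁻ contract L M′⊆

      X : List (A × B)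
      X = proj₁ lifted

      X⊆G : X ⊆ₗ G
      X⊆G = there ∘ L⊆G′ ∘ proj₁ (proj₂ lifted)

      |X|≡|M′| : length X ≡ length M′
      |X|≡|M′| = trans (sym (length-map contract X)) (cong length (proj₂ (proj₂ lifted)))

      merged-X-matching : Unique (map (Sum.map₂ merge) (ends X))
      merged-X-matching = subst Unique (ends-contract X)
        (subst IsMatching (sym (proj₂ (proj₂ lifted))) M′-matching)

      X-matching : IsMatching X
      X-matching = Unique.map⁻ merged-X-matching

      a∉X : inj₁ a ∉ₗ ends X
      a∉X a∈X with ends⁻ X a∈X
      ... | e , e∈X , i = proj₂ (∈-filter⁻ (¬? ∘ incident? (inj₁ a)) {xs = G′} (proj₁ (proj₂ lifted) e∈X)) i

      uncontract : ∀ {x y} → Covers W′ (x , merge y) → Covers W′ (x , y) ⊎ (y ≡ c × inj₂ b ∈ₗ W′)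
      uncontract {y = y} cov with find cov | y ≟ᴮ c
      ... | inj₁ _ , z∈W′ , i    | _        = inj₁ (lose z∈W′ i)
      ... | inj₂ _ , z∈W′ , refl | yes refl = inj₂ (refl , subst (λ y → inj₂ y ∈ₗ W′) merge-c z∈W′)
      ... | inj₂ _ , z∈W′ , refl | no y≢c   = inj₁ (lose z∈W′ (sym (merge-≢c y≢c)))

      uncontract-G′ : ∀ {e} → e ∈ₗ G′ → ¬ Incident (inj₁ a) e → Covers W′ e ⊎ (proj₂ e ≡ c × inj₂ b ∈ₗ W′)
      uncontract-G′ e∈G′ ¬i = uncontract (All.lookup covers′ (∈-map⁺ contract (∈-filter⁺ (¬? ∘ incident? (inj₁ a)) e∈G′ ¬i)))

      cover-part : ∃ λ W → All (Covers W) G × length W ≡ suc (length W′)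
      cover-part with inj₂ b ∈ₗ? W′
      ... | yes b∈W′ = inj₂ c ∷ W′ , there (lose b∈W′ refl) ∷ All.tabulate covers-G′ , refl
        where
        covers-G′ : ∀ {e} → e ∈ₗ G′ → Covers (inj₂ c ∷ W′) e
        covers-G′ {e} e∈G′ with incident? (inj₁ a) e
        ... | yes i = here (cong proj₂ (only e∈G′ i))
        ... | no ¬i with uncontract-G′ e∈G′ ¬i
        ...   | inj₁ cov      = there cov
        ...   | inj₂ (e≡c , _) = here e≡c
      ... | no b∉W′ = inj₁ a ∷ W′ , here refl ∷ All.tabulate covers-G′ , refl
        where
        covers-G′ : ∀ {e} → e ∈ₗ G′ → Covers (inj₁ a ∷ W′) e
        covers-G′ {e} e∈G′ with incident? (inj₁ a) e
        ... | yes i = here i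
        ... | no ¬i with uncontract-G′ e∈G′ ¬i
        ...   | inj₁ cov       = there cov
        ...   | inj₂ (_ , b∈W′) = ⊥-elim (b∉W′ b∈W′)

      matching-part : ∃ λ M → M ⊆ₗ G × IsMatching M × length M ≡ suc (length M′)
      matching-part with inj₂ b ∈ₗ? ends X
      ... | yes b∈X = (a , c) ∷ X
                    , (λ { (here refl) → there ac∈G′ ; (there e∈X) → X⊆G e∈X })
                    , ((λ ()) ∷ All.¬Any⇒All¬ _ a∉X) ∷ All.¬Any⇒All¬ _ c∉X ∷ X-matching
                    , cong suc |X|≡|M′|
        where
        c∉X : inj₂ c ∉ₗ ends X
        c∉X c∈X = c≢b (Sum.inj₂-injective (Unique[map]⇒injectiveOn (Sum.map₂ merge) merged-X-matching
                    c∈X b∈X (cong inj₂ (trans merge-c (sym (merge-≢c (c≢b ∘ sym)))))))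
      ... | no b∉X = (a , b) ∷ X
                   , (λ { (here refl) → here refl ; (there e∈X) → X⊆G e∈X })
                   , ((λ ()) ∷ All.¬Any⇒All¬ _ a∉X) ∷ All.¬Any⇒All¬ _ b∉X ∷ X-matching
                   , cong suc |X|≡|M′|

      result : CoverMatching G
      result with cover-part | matching-part
      ... | W , covers-W , |W| | M , M⊆G , M-matching , |M| = record
        { cover = W ; matching = M ; covers = covers-W ; matching⊆G = M⊆G ; isMatching = M-matching
        ; cover≤matching = subst₂ _≤_ (sym |W|) (sym |M|) (s≤s W′≤M′) }

    only-edge : ∀ c → ¬ Any (λ f → Incident (inj₁ a) f × f ≢ (a , c)) G′ →
      ∀ {e} → e ∈ₗ G′ → Incident (inj₁ a) e → e ≡ (a , c)
    only-edge c ¬other {e} e∈G′ i with e ≟ᵉ (a , c)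
    ... | yes e≡ac = e≡ac
    ... | no e≢ac = ⊥-elim (¬other (lose e∈G′ (i , e≢ac)))

    result : CoverMatching G
    result with inj₁ a ∈ₗ? ends M₁
    ... | no a∉M₁ = a-unmatched a∉M₁
    ... | yes a∈M₁ with ends⁻ M₁ a∈M₁
    ...   | (_ , c) , ac∈M₁ , refl with Any.any? (λ f → incident? (inj₁ a) f ×-dec ¬? (f ≟ᵉ (a , c))) G′
    ...     | no ¬other = OnlyEdgeAtA.result c ac∈M₁ (only-edge c ¬other)
    ...     | yes other with find other
    ...       | f , f∈G′ , a-f , f≢ac = SecondEdgeAtA.result (a , c) ac∈M₁ refl f f∈G′ a-f f≢ac

  konig-≤ : ∀ k G → length G ≤ k → CoverMatching G
  konig-≤ _ [] _ = record
    { cover = [] ; matching = [] ; covers = [] ; matching⊆G = λ () ; isMatching = [] ; cover≤matching = z≤n }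
  konig-≤ (suc k) ((a , b) ∷ G′) (s≤s |G′|≤k) =
    KonigStep.result a b G′ λ H |H|≤|G′| → konig-≤ k H (≤-trans |H|≤|G′| |G′|≤k)

  konig : ∀ G → CoverMatching G
  konig G = konig-≤ (length G) G ≤-refl

  large-matching : ∀ {Δ} G → (∀ z → degree z G ≤ Δ) →
    ∃ λ M → M ⊆ₗ G × IsMatching M × length G ≤ length M * Δ
  large-matching {Δ} G deg = matching , matching⊆G , isMatching ,
    ≤-trans (edges≤cover*degree cover G covers deg) (*-monoˡ-≤ Δ cover≤matching)
    where open CoverMatching (konig G)

module _ {n : ℕ} where

  Unique⇒length≤∣∣ : (S : Subset n) (xs : List (Fin n)) → Unique xs → All (_∈ S) xs → length xs ≤ ∣ S ∣
  Unique⇒length≤∣∣ S [] _ _ = z≤n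
  Unique⇒length≤∣∣ S (x ∷ xs) (x∉ ∷ u) (x∈S ∷ xs⊆S) =
    ≤-trans (s≤s (Unique⇒length≤∣∣ (S - x) xs u xs⊆S-x)) (x∈p⇒∣p-x∣<∣p∣ x∈S)
    where
    xs⊆S-x : All (_∈ S - x) xs
    xs⊆S-x = All.tabulate λ y∈xs → x∈p∧x≢y⇒x∈p-y (All.lookup xs⊆S y∈xs) (All.lookup x∉ y∈xs ∘ sym)

  Other : Subset n → Fin n → Set
  Other S v = ∃ λ x → x ∈ S × x ≢ v

  other? : ∀ S v → Dec (Other S v)
  other? S v = Fin.any? λ x → (x ∈? S) ×-dec ¬? (x Fin.≟ v)

  no-other⇒⊆⁅v⁆ : ∀ {S v} → ¬ Other S v → S ⊆ ⁅ v ⁆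
  no-other⇒⊆⁅v⁆ {S} {v} ¬other {x} x∈S with x Fin.≟ v
  ... | yes refl = x∈⁅x⁆ x
  ... | no x≢v   = ⊥-elim (¬other (x , x∈S , x≢v))

  2≤∣S∣⇒Other : ∀ {S} v → 2 ≤ ∣ S ∣ → Other S v
  2≤∣S∣⇒Other {S} v 2≤∣S∣ with other? S v
  ... | yes other = other
  ... | no ¬other = contradiction 2≤∣S∣
        (≤⇒≯ (≤-trans (p⊆q⇒∣p∣≤∣q∣ (no-other⇒⊆⁅v⁆ ¬other)) (≤-reflexive (∣⁅x⁆∣≡1 v))))

  v∉S∧1≤∣S∣⇒Other : ∀ {S v} → v ∉ S → 1 ≤ ∣ S ∣ → Other S v
  v∉S∧1≤∣S∣⇒Other {S} {v} v∉S 1≤∣S∣ with other? S v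
  ... | yes other = other
  ... | no ¬other = contradiction 1≤∣S∣
        (≤⇒≯ (≤-trans (p⊆q⇒∣p∣≤∣q∣ S⊆⊥) (≤-reflexive (∣⊥∣≡0 n))))
    where
    S⊆⊥ : S ⊆ ⊥
    S⊆⊥ x∈S = ⊥-elim (v∉S (subst (_∈ S) (x∈⁅y⁆⇒x≡y v (no-other⇒⊆⁅v⁆ ¬other x∈S)) x∈S))

  T⇒∈ : ∀ {x : Fin n} {S} → T (lookup S x) → x ∈ S
  T⇒∈ {x} {S} t = lookup⇒[]= x S (Equivalence.to T-≡ t)

  ∈⇒T : ∀ {x : Fin n} {S} → x ∈ S → T (lookup S x)
  ∈⇒T x∈S = Equivalence.from T-≡ ([]=⇒lookup x∈S)

  ∉⇒lookup≡false : ∀ {x : Fin n} {S} → x ∉ S → lookup S x ≡ false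
  ∉⇒lookup≡false {x} {S} x∉S with lookup S x in eq
  ... | true  = ⊥-elim (x∉S (lookup⇒[]= x S eq))
  ... | false = refl

indicator : ℕ → ℕ → ℕ
indicator s k = if s ≡ᵇ k then 1 else 0

sum-indicator≡0 : ∀ s ks → All (s ≢_) ks → sum (map (indicator s) ks) ≡ 0
sum-indicator≡0 s [] _ = refl
sum-indicator≡0 s (k ∷ ks) (s≢k ∷ s∉ks) with s ≡ᵇ k in eq
... | true  = ⊥-elim (s≢k (≡ᵇ⇒≡ s k (subst T (sym eq) _)))
... | false = sum-indicator≡0 s ks s∉ks

sum-indicator≤1 : ∀ s ks → Unique ks → sum (map (indicator s) ks) ≤ 1
sum-indicator≤1 s [] _ = z≤n
sum-indicator≤1 s (k ∷ ks) (k∉ks ∷ u) with s ≡ᵇ k in eq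
... | false = sum-indicator≤1 s ks u
... | true with ≡ᵇ⇒≡ s k (subst T (sym eq) _)
...   | refl = ≤-reflexive (cong suc (sum-indicator≡0 s ks k∉ks))

sum-map-0 : {A : Set} (xs : List A) → sum (map (λ _ → 0) xs) ≡ 0
sum-map-0 [] = refl
sum-map-0 (_ ∷ xs) = sum-map-0 xs

sum-map-+ : {A : Set} (f g : A → ℕ) (xs : List A) →
  sum (map (λ x → f x + g x) xs) ≡ sum (map f xs) + sum (map g xs)
sum-map-+ f g [] = refl
sum-map-+ f g (x ∷ xs) = trans (cong (f x + g x +_) (sum-map-+ f g xs)) (interchange (f x) (g x) _ _)

module _ {n : ℕ} (v : Fin n) (U : Subset n) (lo : ℕ) where

  Counted : Edge n → Set
  Counted e = v ∈ e × lo ≤ ∣ e ∩ U ∣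

  counted? : Decidable Counted
  counted? e = (v ∈? e) ×-dec (lo ≤? ∣ e ∩ U ∣)

  counted-edge≤1 : ∀ {e} ks → Unique ks → Counted e →
    sum (map (λ k → if lookup e v ∧ (∣ e ∩ U ∣ ≡ᵇ k) then 1 else 0) ks) ≤ 1
  counted-edge≤1 {e} ks u (v∈e , _) rewrite []=⇒lookup v∈e = sum-indicator≤1 ∣ e ∩ U ∣ ks u

  uncounted-edge≡0 : ∀ {e} ks → All (lo ≤_) ks → ¬ Counted e →
    sum (map (λ k → if lookup e v ∧ (∣ e ∩ U ∣ ≡ᵇ k) then 1 else 0) ks) ≡ 0
  uncounted-edge≡0 {e} ks lo≤ks ¬counted with v ∈? e
  ... | no v∉e  rewrite ∉⇒lookup≡false v∉e = sum-map-0 ks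
  ... | yes v∈e rewrite []=⇒lookup v∈e = sum-indicator≡0 ∣ e ∩ U ∣ ks
        (All.map (λ lo≤k s≡k → ¬counted (v∈e , subst (lo ≤_) (sym s≡k) lo≤k)) lo≤ks)

  sum-eCount≤ : ∀ ks → Unique ks → All (lo ≤_) ks → ∀ es →
    sum (map (λ k → eCount es k v U) ks) ≤ length (filter counted? es)
  sum-eCount≤ ks _ _ [] = ≤-reflexive (sum-map-0 ks)
  sum-eCount≤ ks u lo≤ks (e ∷ es) =
    ≤-trans (≤-reflexive (sum-map-+ _ _ ks)) (split (counted? e))
    where
    rest≤ : sum (map (λ k → eCount es k v U) ks) ≤ length (filter counted? es)
    rest≤ = sum-eCount≤ ks u lo≤ks es
    split : Dec (Counted e) →
      sum (map (λ k → if lookup e v ∧ (∣ e ∩ U ∣ ≡ᵇ k) then 1 else 0) ks) + sum (map (λ k → eCount es k v U) ks)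
        ≤ length (filter counted? (e ∷ es))
    split (yes counted) = subst (λ xs → _ ≤ length xs) (sym (filter-accept counted? counted))
      (+-mono-≤ (counted-edge≤1 ks u counted) rest≤)
    split (no ¬counted) = subst (λ xs → _ ≤ length xs) (sym (filter-reject counted? ¬counted))
      (≤-trans (≤-reflexive (cong (_+ _) (uncounted-edge≡0 ks lo≤ks ¬counted))) rest≤)

  sumRange-eCount≤ : ∀ hi es → sumRange lo hi (λ k → eCount es k v U) ≤ length (filter counted? es)
  sumRange-eCount≤ hi es = subst (_≤ length (filter counted? es)) (cong sum (sym (map-∘ (upTo (suc hi ∸ lo)))))
    (sum-eCount≤ (map (lo +_) (upTo (suc hi ∸ lo)))
      (Unique.map⁺ (+-cancelˡ-≡ lo _ _) (Unique.upTo⁺ _))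
      (All.map⁺ (All.tabulate λ _ → m≤m+n lo _)) es)

module _ {n : ℕ} (E : List (Edge n)) where

  adjacent⇒edge : ∀ {x y} → Adjacent E x y → x ≢ y × ∃ λ i → x ∈ edge E i × y ∈ edge E i
  adjacent⇒edge {x} {y} adj with x Fin.≟ y
  ... | yes _   with () ← adj
  ... | no x≢y  = x≢y , Any.index p , T⇒∈ (proj₁ x∧y) , T⇒∈ (proj₂ x∧y)
    where
    p : Any (λ e → T (lookup e x ∧ lookup e y)) E
    p = any⁻ (λ e → lookup e x ∧ lookup e y) E (Equivalence.from T-≡ adj)
    x∧y : T (lookup (edge E (Any.index p)) x) × T (lookup (edge E (Any.index p)) y)
    x∧y = Equivalence.to T-∧ (lookup-index p)

  edge⇒adjacent : ∀ {x y} i → x ≢ y → x ∈ edge E i → y ∈ edge E i → Adjacent E x y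
  edge⇒adjacent {x} {y} i x≢y x∈i y∈i with x Fin.≟ y
  ... | yes x≡y = ⊥-elim (x≢y x≡y)
  ... | no _    = Equivalence.to T-≡ (any⁺ (λ e → lookup e x ∧ lookup e y)
                    (Any.map (λ { refl → Equivalence.from T-∧ (∈⇒T x∈i , ∈⇒T y∈i) }) (∈-lookup {xs = E} i)))

  ∈Nbhd⁻ : ∀ {x y} → y ∈ Nbhd E x → Adjacent E x y
  ∈Nbhd⁻ {x} {y} y∈N = trans (sym (lookup∘tabulate (adjᵇ E x) y)) ([]=⇒lookup y∈N)

  ∈Nbhd⁺ : ∀ {x y} → Adjacent E x y → y ∈ Nbhd E x
  ∈Nbhd⁺ {x} {y} adj = lookup⇒[]= y (Nbhd E x) (trans (lookup∘tabulate (adjᵇ E x) y) adj)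

  ∈Ncommon⇒≢ : ∀ {u w x} → x ∈ Ncommon E u w → x ≢ u × x ≢ w
  ∈Ncommon⇒≢ {u} {w} x∈U with x∈p∩q⁻ (Nbhd E u) (Nbhd E w) x∈U
  ... | x∈Nu , x∈Nw = (λ { refl → proj₁ (adjacent⇒edge (∈Nbhd⁻ x∈Nu)) refl })
                    , (λ { refl → proj₁ (adjacent⇒edge (∈Nbhd⁻ x∈Nw)) refl })

  linear⇒edge-unique : Linear E → ∀ {x y i j} → x ≢ y →
    x ∈ edge E i → y ∈ edge E i → x ∈ edge E j → y ∈ edge E j → i ≡ j
  linear⇒edge-unique linear {x} {y} {i} {j} x≢y x∈i y∈i x∈j y∈j with i Fin.≟ j
  ... | yes i≡j = i≡j
  ... | no i≢j  = contradiction (linear i j i≢j) (<⇒≱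
        (Unique⇒length≤∣∣ (edge E i ∩ edge E j) (x ∷ y ∷ []) ((x≢y ∷ []) ∷ [] ∷ [])
          (x∈p∩q⁺ (x∈i , x∈j) ∷ x∈p∩q⁺ (y∈i , y∈j) ∷ [])))

module Local {n r t : ℕ} (E : List (Edge n))
  (edge-size : ∀ i → ∣ edge E i ∣ ≡ r) (linear : Linear E) (K₃ₜ-free : BergeK3tFree E t)
  {u w : Fin n} (u≢w : u ≢ w) (l : EIdx E) (u∈l : u ∈ edge E l) (w∈l : w ∈ edge E l)
  {v : Fin n} (v≢u : v ≢ u) (v≢w : v ≢ w) where

  I : Set
  I = EIdx E

  U : Subset n
  U = Ncommon E u w

  edge-unique : ∀ {x y i j} → x ≢ y →
    x ∈ edge E i → y ∈ edge E i → x ∈ edge E j → y ∈ edge E j → i ≡ j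
  edge-unique = linear⇒edge-unique E linear

  Relevant : I → Set
  Relevant i = v ∈ edge E i × Other (edge E i ∩ U) v

  relevant? : Decidable Relevant
  relevant? i = (v ∈? edge E i) ×-dec other? (edge E i ∩ U) v

  R : List I
  R = filter relevant? (allFin (length E))

  R-unique : Unique R
  R-unique = Unique.filter⁺ relevant? (Unique.allFin⁺ _)

  R-relevant : ∀ {i} → i ∈ₗ R → Relevant i
  R-relevant = proj₂ ∘ ∈-filter⁻ relevant? {xs = allFin _}

  xOf : I → Fin n
  xOf i = witnessOr (λ x → (x ∈? edge E i ∩ U) ×-dec ¬? (x Fin.≟ v)) v

  xOf-spec : ∀ {i} → i ∈ₗ R → xOf i ∈ edge E i × xOf i ∈ U × xOf i ≢ v
  xOf-spec {i} i∈R with witnessOr-satisfies (λ x → (x ∈? edge E i ∩ U) ×-dec ¬? (x Fin.≟ v)) v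
                          (proj₂ (R-relevant i∈R))
  ... | x∈i∩U , x≢v = proj₁ (x∈p∩q⁻ (edge E i) U x∈i∩U) , proj₂ (x∈p∩q⁻ (edge E i) U x∈i∩U) , x≢v

  xOf-injective : ∀ {i j} → i ∈ₗ R → j ∈ₗ R → xOf i ≡ xOf j → i ≡ j
  xOf-injective {i} {j} i∈R j∈R x≡ = edge-unique (proj₂ (proj₂ (xOf-spec i∈R)))
    (proj₁ (xOf-spec i∈R)) (proj₁ (R-relevant i∈R))
    (subst (_∈ edge E j) (sym x≡) (proj₁ (xOf-spec j∈R))) (proj₁ (R-relevant j∈R))

  xOf≢u : ∀ {i} → i ∈ₗ R → xOf i ≢ u
  xOf≢u = proj₁ ∘ ∈Ncommon⇒≢ E ∘ proj₁ ∘ proj₂ ∘ xOf-spec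

  xOf≢w : ∀ {i} → i ∈ₗ R → xOf i ≢ w
  xOf≢w = proj₂ ∘ ∈Ncommon⇒≢ E ∘ proj₁ ∘ proj₂ ∘ xOf-spec

  through : Fin n → Fin n → I
  through y z = witnessOr (λ i → (y ∈? edge E i) ×-dec (z ∈? edge E i)) l

  through-spec : ∀ {y z} → Adjacent E y z → y ∈ edge E (through y z) × z ∈ edge E (through y z)
  through-spec {y} {z} adj =
    witnessOr-satisfies (λ i → (y ∈? edge E i) ×-dec (z ∈? edge E i)) l (proj₂ (adjacent⇒edge E adj))

  uEdge wEdge : I → I
  uEdge i = through u (xOf i)
  wEdge i = through w (xOf i)

  uEdge-spec : ∀ {i} → i ∈ₗ R → u ∈ edge E (uEdge i) × xOf i ∈ edge E (uEdge i)
  uEdge-spec i∈R = through-spec (∈Nbhd⁻ E (proj₁ (x∈p∩q⁻ (Nbhd E u) (Nbhd E w) (proj₁ (proj₂ (xOf-spec i∈R))))))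

  wEdge-spec : ∀ {i} → i ∈ₗ R → w ∈ edge E (wEdge i) × xOf i ∈ edge E (wEdge i)
  wEdge-spec i∈R = through-spec (∈Nbhd⁻ E (proj₂ (x∈p∩q⁻ (Nbhd E u) (Nbhd E w) (proj₁ (proj₂ (xOf-spec i∈R))))))

  MeetsUW : I → Set
  MeetsUW i = u ∈ edge E i ⊎ w ∈ edge E i

  meetsUW? : Decidable MeetsUW
  meetsUW? i = (u ∈? edge E i) ⊎-dec (w ∈? edge E i)

  XOnL : I → Set
  XOnL i = xOf i ∈ edge E l

  xOnL? : Decidable XOnL
  xOnL? i = xOf i ∈? edge E l

  Rᵘʷ R′ Rˡ Rᵍ : List I
  Rᵘʷ = filter meetsUW? R
  R′  = filter (¬? ∘ meetsUW?) R
  Rˡ  = filter xOnL? R′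
  Rᵍ  = filter (¬? ∘ xOnL?) R′

  |R|-split : length R ≡ length Rᵘʷ + (length Rˡ + length Rᵍ)
  |R|-split = trans (length-filter-∁ meetsUW? R) (cong (length Rᵘʷ +_) (length-filter-∁ xOnL? R′))

  R′-spec : ∀ {i} → i ∈ₗ R′ → i ∈ₗ R × ¬ MeetsUW i
  R′-spec = ∈-filter⁻ (¬? ∘ meetsUW?) {xs = R}

  Rᵍ-spec : ∀ {i} → i ∈ₗ Rᵍ → i ∈ₗ R × ¬ MeetsUW i × ¬ XOnL i
  Rᵍ-spec i∈Rᵍ with ∈-filter⁻ (¬? ∘ xOnL?) {xs = R′} i∈Rᵍ
  ... | i∈R′ , ¬onL = proj₁ (R′-spec i∈R′) , proj₂ (R′-spec i∈R′) , ¬onL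

  Rᵍ-unique : Unique Rᵍ
  Rᵍ-unique = Unique.filter⁺ _ (Unique.filter⁺ _ R-unique)

  through-≤1 : ∀ {y} → y ≢ v → length (filter (λ i → y ∈? edge E i) R) ≤ 1
  through-≤1 {y} y≢v = Unique∧allEqual⇒length≤1 _ (Unique.filter⁺ _ R-unique) λ i∈ j∈ →
    let i∈R , y∈i = ∈-filter⁻ (λ i → y ∈? edge E i) {xs = R} i∈
        j∈R , y∈j = ∈-filter⁻ (λ i → y ∈? edge E i) {xs = R} j∈
    in edge-unique y≢v y∈i (proj₁ (R-relevant i∈R)) y∈j (proj₁ (R-relevant j∈R))

  |Rᵘʷ|≤ : length Rᵘʷ ≤ length (filter (λ i → u ∈? edge E i) R) + length (filter (λ i → w ∈? edge E i) R)
  |Rᵘʷ|≤ = length-filter-⊎ (λ i → u ∈? edge E i) (λ i → w ∈? edge E i) R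

  |Rᵘʷ|≤2 : length Rᵘʷ ≤ 2
  |Rᵘʷ|≤2 = ≤-trans |Rᵘʷ|≤ (+-mono-≤ (through-≤1 (v≢u ∘ sym)) (through-≤1 (v≢w ∘ sym)))

  v∉Nw⇒|Rᵘʷ|≤1 : v ∉ Nbhd E w → length Rᵘʷ ≤ 1
  v∉Nw⇒|Rᵘʷ|≤1 v∉Nw = ≤-trans |Rᵘʷ|≤ (+-mono-≤ (through-≤1 (v≢u ∘ sym))
    (≤-reflexive (cong length (filter-none (λ i → w ∈? edge E i) (All.tabulate λ {i} i∈R w∈i →
      v∉Nw (∈Nbhd⁺ E (edge⇒adjacent E i (v≢w ∘ sym) w∈i (proj₁ (R-relevant i∈R)))))))))

  v∈l⇒|Rᵘʷ|≤1 : v ∈ edge E l → length Rᵘʷ ≤ 1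
  v∈l⇒|Rᵘʷ|≤1 v∈l = Unique∧allEqual⇒length≤1 Rᵘʷ (Unique.filter⁺ _ R-unique) λ i∈ j∈ → trans (≡l i∈) (sym (≡l j∈))
    where
    ≡l : ∀ {i} → i ∈ₗ Rᵘʷ → i ≡ l
    ≡l i∈ with ∈-filter⁻ meetsUW? {xs = R} i∈
    ... | i∈R , inj₁ u∈i = edge-unique v≢u (proj₁ (R-relevant i∈R)) u∈i v∈l u∈l
    ... | i∈R , inj₂ w∈i = edge-unique v≢w (proj₁ (R-relevant i∈R)) w∈i v∈l w∈l

  chosen-in-edge≤ : ∀ j ys Ls → Unique ys → All (_∈ edge E j) ys → Unique Ls →
    (∀ {i} → i ∈ₗ Ls → i ∈ₗ R × xOf i ∈ edge E j × xOf i ∉ₗ ys) → length Ls ≤ r ∸ length ys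
  chosen-in-edge≤ j ys Ls ys-unique ys⊆j Ls-unique spec = m+n≤o⇒m≤o∸n (length Ls) (begin
    length Ls + length ys         ≡⟨ cong (_+ length ys) (sym (length-map xOf Ls)) ⟩
    length (map xOf Ls) + length ys ≡⟨ sym (length-++ (map xOf Ls)) ⟩
    length (map xOf Ls ++ ys)     ≤⟨ Unique⇒length≤∣∣ (edge E j) _ zs-unique zs⊆j ⟩
    ∣ edge E j ∣                  ≡⟨ edge-size j ⟩
    r                             ∎)
    where
    open ≤-Reasoning
    disjoint : Disjoint (map xOf Ls) ys
    disjoint (x∈ , x∈ys) with ∈-map⁻ xOf x∈
    ... | i , i∈Ls , refl = proj₂ (proj₂ (spec i∈Ls)) x∈ys
    zs-unique : Unique (map xOf Ls ++ ys)
    zs-unique = Unique.++⁺ (injectiveOn⇒Unique[map] xOf Ls-unique λ i∈ j∈ → xOf-injective (proj₁ (spec i∈)) (proj₁ (spec j∈)))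
                           ys-unique disjoint
    zs⊆j : All (_∈ edge E j) (map xOf Ls ++ ys)
    zs⊆j = All.++⁺ (All.map⁺ (All.tabulate (proj₁ ∘ proj₂ ∘ spec))) ys⊆j

  |Rˡ|≤r∸2 : length Rˡ ≤ r ∸ 2
  |Rˡ|≤r∸2 = chosen-in-edge≤ l (u ∷ w ∷ []) Rˡ ((u≢w ∷ []) ∷ [] ∷ []) (u∈l ∷ w∈l ∷ [])
    (Unique.filter⁺ _ (Unique.filter⁺ _ R-unique)) spec
    where
    spec : ∀ {i} → i ∈ₗ Rˡ → i ∈ₗ R × xOf i ∈ edge E l × xOf i ∉ₗ u ∷ w ∷ []
    spec i∈ with ∈-filter⁻ xOnL? {xs = R′} i∈
    ... | i∈R′ , onL = let i∈R = proj₁ (R′-spec i∈R′) in i∈R , onL ,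
      λ { (here x≡u) → xOf≢u i∈R x≡u ; (there (here x≡w)) → xOf≢w i∈R x≡w }

  v∈l⇒|Rˡ|≡0 : v ∈ edge E l → length Rˡ ≡ 0
  v∈l⇒|Rˡ|≡0 v∈l = cong length (filter-none xOnL? (All.tabulate λ i∈R′ onL →
    let i∈R , ¬meets = R′-spec i∈R′
        i≡l = edge-unique (proj₂ (proj₂ (xOf-spec i∈R))) (proj₁ (xOf-spec i∈R)) (proj₁ (R-relevant i∈R)) onL v∈l
    in ¬meets (inj₁ (subst (λ k → u ∈ edge E k) (sym i≡l) u∈l))))

  uEdge≢wEdge : ∀ {i j} → i ∈ₗ R → j ∈ₗ Rᵍ → uEdge i ≢ wEdge j
  uEdge≢wEdge {i} {j} i∈R j∈Rᵍ same = proj₂ (proj₂ (Rᵍ-spec j∈Rᵍ))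
    (subst (λ k → xOf j ∈ edge E k) wEdge≡l (proj₂ (wEdge-spec j∈R)))
    where
    j∈R : j ∈ₗ R
    j∈R = proj₁ (Rᵍ-spec j∈Rᵍ)
    wEdge≡l : wEdge j ≡ l
    wEdge≡l = edge-unique u≢w (subst (λ k → u ∈ edge E k) same (proj₁ (uEdge-spec i∈R)))
                          (proj₁ (wEdge-spec j∈R)) u∈l w∈l

  uEdge≢Rᵍ : ∀ {i j} → i ∈ₗ R → j ∈ₗ Rᵍ → uEdge i ≢ j
  uEdge≢Rᵍ i∈R j∈Rᵍ refl = proj₁ (proj₂ (Rᵍ-spec j∈Rᵍ)) (inj₁ (proj₁ (uEdge-spec i∈R)))

  wEdge≢Rᵍ : ∀ {i j} → i ∈ₗ R → j ∈ₗ Rᵍ → wEdge i ≢ j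
  wEdge≢Rᵍ i∈R j∈Rᵍ refl = proj₁ (proj₂ (Rᵍ-spec j∈Rᵍ)) (inj₂ (proj₁ (wEdge-spec i∈R)))

  module _ (side : I → I) (y : Fin n)
           (side-spec : ∀ {i} → i ∈ₗ R → y ∈ edge E (side i) × xOf i ∈ edge E (side i))
           (xOf≢y : ∀ {i} → i ∈ₗ R → xOf i ≢ y) where

    fibre≤r∸1 : ∀ j Ls → Unique Ls → (∀ {i} → i ∈ₗ Ls → i ∈ₗ R × side i ≡ j) → length Ls ≤ r ∸ 1
    fibre≤r∸1 j [] _ _ = z≤n
    fibre≤r∸1 j Ls@(_ ∷ _) Ls-unique spec = chosen-in-edge≤ j (y ∷ []) Ls ([] ∷ []) (y∈j ∷ []) Ls-unique λ i∈ →
      let i∈R , side≡j = spec i∈ in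
      i∈R , subst (λ k → xOf _ ∈ edge E k) side≡j (proj₂ (side-spec i∈R)) , λ { (here x≡y) → xOf≢y i∈R x≡y }
      where
      y∈j : y ∈ edge E j
      y∈j = subst (λ k → y ∈ edge E k) (proj₂ (spec (here refl))) (proj₁ (side-spec (proj₁ (spec (here refl)))))

  open Bipartite (Fin._≟_ {length E}) (Fin._≟_ {length E})

  pair : I → I × I
  pair i = uEdge i , wEdge i

  degree-pairs≤ : ∀ z → degree z (map pair Rᵍ) ≤ r ∸ 1
  degree-pairs≤ z = subst (_≤ r ∸ 1) (sym (length-filter-map (incident? z) pair Rᵍ)) (at z)
    where
    Ls : ∀ z → List I
    Ls z = filter (incident? z ∘ pair) Rᵍ
    Ls-spec : ∀ z {i} → i ∈ₗ Ls z → i ∈ₗ R × Incident z (pair i)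
    Ls-spec z i∈ with ∈-filter⁻ (incident? z ∘ pair) {xs = Rᵍ} i∈
    ... | i∈Rᵍ , inc = proj₁ (Rᵍ-spec i∈Rᵍ) , inc
    at : ∀ z → length (Ls z) ≤ r ∸ 1
    at (inj₁ j) = fibre≤r∸1 uEdge u uEdge-spec xOf≢u j (Ls (inj₁ j)) (Unique.filter⁺ _ Rᵍ-unique) (Ls-spec (inj₁ j))
    at (inj₂ j) = fibre≤r∸1 wEdge w wEdge-spec xOf≢w j (Ls (inj₂ j)) (Unique.filter⁺ _ Rᵍ-unique) (Ls-spec (inj₂ j))

  module BergeCopy (M : List (I × I)) (M⊆ : M ⊆ₗ map pair Rᵍ) (M-matching : IsMatching M)
                   (t≤|M| : t ≤ length M) where

    pos : Fin t → Fin (length M)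
    pos b = inject≤ b t≤|M|

    preimage : ∀ b → ∃ λ i → i ∈ₗ Rᵍ × List.lookup M (pos b) ≡ pair i
    preimage b = ∈-map⁻ pair (M⊆ (∈-lookup (pos b)))

    e : Fin t → I
    e b = proj₁ (preimage b)

    e∈Rᵍ : ∀ b → e b ∈ₗ Rᵍ
    e∈Rᵍ b = proj₁ (proj₂ (preimage b))

    e∈R : ∀ b → e b ∈ₗ R
    e∈R b = proj₁ (Rᵍ-spec (e∈Rᵍ b))

    lookup≡pair : ∀ b → List.lookup M (pos b) ≡ pair (e b)
    lookup≡pair b = proj₂ (proj₂ (preimage b))

    pos-injective : ∀ {b b′} → pos b ≡ pos b′ → b ≡ b′
    pos-injective = Fin.inject≤-injective _ _ _ _

    uEdge∘e-injective : Injective _≡_ _≡_ (uEdge ∘ e)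
    uEdge∘e-injective {b} {b′} same = pos-injective (matching-lookup-injective {inj₁ (uEdge (e b))} M M-matching (pos b) (pos b′)
      (cong proj₁ (lookup≡pair b)) (trans (cong proj₁ (lookup≡pair b′)) (sym same)))

    wEdge∘e-injective : Injective _≡_ _≡_ (wEdge ∘ e)
    wEdge∘e-injective {b} {b′} same = pos-injective (matching-lookup-injective {inj₂ (wEdge (e b))} M M-matching (pos b) (pos b′)
      (cong proj₂ (lookup≡pair b)) (trans (cong proj₂ (lookup≡pair b′)) (sym same)))

    corner : Fin 3 → Fin n
    corner 0F = u
    corner 1F = w
    corner 2F = v

    corner-injective : Injective _≡_ _≡_ corner
    corner-injective {0F} {0F} _ = refl
    corner-injective {0F} {1F} u≡w = ⊥-elim (u≢w u≡w)
    corner-injective {0F} {2F} u≡v = ⊥-elim (v≢u (sym u≡v))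
    corner-injective {1F} {0F} w≡u = ⊥-elim (u≢w (sym w≡u))
    corner-injective {1F} {1F} _ = refl
    corner-injective {1F} {2F} w≡v = ⊥-elim (v≢w (sym w≡v))
    corner-injective {2F} {0F} v≡u = ⊥-elim (v≢u v≡u)
    corner-injective {2F} {1F} v≡w = ⊥-elim (v≢w v≡w)
    corner-injective {2F} {2F} _ = refl

    corner≢xOf : ∀ a b → corner a ≢ xOf (e b)
    corner≢xOf 0F b u≡x = xOf≢u (e∈R b) (sym u≡x)
    corner≢xOf 1F b w≡x = xOf≢w (e∈R b) (sym w≡x)
    corner≢xOf 2F b v≡x = proj₂ (proj₂ (xOf-spec (e∈R b))) (sym v≡x)

    vertex : Fin 3 ⊎ Fin t → Fin n
    vertex = [ corner , xOf ∘ e ]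

    vertex-injective : Injective _≡_ _≡_ vertex
    vertex-injective = [,]-injective corner-injective
      (λ x≡ → uEdge∘e-injective (cong uEdge (xOf-injective (e∈R _) (e∈R _) x≡))) corner≢xOf

    edgeOf : Fin 3 × Fin t → I
    edgeOf (0F , b) = uEdge (e b)
    edgeOf (1F , b) = wEdge (e b)
    edgeOf (2F , b) = e b

    edgeOf-injective : Injective _≡_ _≡_ edgeOf
    edgeOf-injective {0F , b} {0F , b′} eq = cong (0F ,_) (uEdge∘e-injective eq)
    edgeOf-injective {0F , b} {1F , b′} eq = ⊥-elim (uEdge≢wEdge (e∈R b) (e∈Rᵍ b′) eq)
    edgeOf-injective {0F , b} {2F , b′} eq = ⊥-elim (uEdge≢Rᵍ (e∈R b) (e∈Rᵍ b′) eq)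
    edgeOf-injective {1F , b} {0F , b′} eq = ⊥-elim (uEdge≢wEdge (e∈R b′) (e∈Rᵍ b) (sym eq))
    edgeOf-injective {1F , b} {1F , b′} eq = cong (1F ,_) (wEdge∘e-injective eq)
    edgeOf-injective {1F , b} {2F , b′} eq = ⊥-elim (wEdge≢Rᵍ (e∈R b) (e∈Rᵍ b′) eq)
    edgeOf-injective {2F , b} {0F , b′} eq = ⊥-elim (uEdge≢Rᵍ (e∈R b′) (e∈Rᵍ b) (sym eq))
    edgeOf-injective {2F , b} {1F , b′} eq = ⊥-elim (wEdge≢Rᵍ (e∈R b′) (e∈Rᵍ b) (sym eq))
    edgeOf-injective {2F , b} {2F , b′} eq = cong (2F ,_) (uEdge∘e-injective (cong uEdge eq))

    incidence : ∀ a b → vertex (inj₁ a) ∈ edge E (edgeOf (a , b)) × vertex (inj₂ b) ∈ edge E (edgeOf (a , b))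
    incidence 0F b = uEdge-spec (e∈R b)
    incidence 1F b = wEdge-spec (e∈R b)
    incidence 2F b = proj₁ (R-relevant (e∈R b)) , proj₁ (xOf-spec (e∈R b))

    copy : BergeK3t E t
    copy = vertex , edgeOf , vertex-injective , edgeOf-injective , incidence

  |Rᵍ|≤ : length Rᵍ ≤ (t ∸ 1) * (r ∸ 1)
  |Rᵍ|≤ = ≮⇒≥ λ many → K₃ₜ-free (copy-from many)
    where
    copy-from : (t ∸ 1) * (r ∸ 1) < length Rᵍ → BergeK3t E t
    copy-from many with large-matching (map pair Rᵍ) degree-pairs≤
    ... | M , M⊆ , M-matching , |pairs|≤ = BergeCopy.copy M M⊆ M-matching
      (∸1<⇒≤ t (*-cancelʳ-< _ _ _ (<-≤-trans many (subst (_≤ _) (length-map pair Rᵍ) |pairs|≤))))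
      where
      ∸1<⇒≤ : ∀ m {k} → m ∸ 1 < k → m ≤ k
      ∸1<⇒≤ zero _ = z≤n
      ∸1<⇒≤ (suc m) m<k = m<k

  sumRange≤|R| : ∀ lo hi → (∀ {e} → v ∈ e → lo ≤ ∣ e ∩ U ∣ → Other (e ∩ U) v) →
    sumRange lo hi (λ k → eCount E k v U) ≤ length R
  sumRange≤|R| lo hi other = begin
    sumRange lo hi (λ k → eCount E k v U)                         ≤⟨ sumRange-eCount≤ v U lo hi E ⟩
    length (filter (counted? v U lo) E)                           ≡⟨ cong (length ∘ filter (counted? v U lo)) E≡ ⟩
    length (filter (counted? v U lo) (map (edge E) (allFin _)))   ≡⟨ length-filter-map (counted? v U lo) (edge E) (allFin _) ⟩
    length (filter (counted? v U lo ∘ edge E) (allFin _))         ≤⟨ length-filter-mono _ relevant? relevant (allFin _) ⟩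
    length R                                                      ∎
    where
    open ≤-Reasoning
    E≡ : E ≡ map (edge E) (allFin (length E))
    E≡ = sym (trans (map-tabulate id (List.lookup E)) (tabulate-lookup E))
    relevant : ∀ {i} → Counted v U lo (edge E i) → Relevant i
    relevant (v∈i , lo≤) = v∈i , other v∈i lo≤

  |R|≤ : ∀ {a b} → length Rᵘʷ ≤ a → length Rˡ ≤ b → length R ≤ a + (b + (t ∸ 1) * (r ∸ 1))
  |R|≤ |Rᵘʷ|≤a |Rˡ|≤b = ≤-trans (≤-reflexive |R|-split) (+-mono-≤ |Rᵘʷ|≤a (+-mono-≤ |Rˡ|≤b |Rᵍ|≤))

2+[r∸2]+[t∸1][r∸1]≤t[r∸1]+1 : ∀ r t → 2 ≤ r → 1 ≤ t → 2 + ((r ∸ 2) + (t ∸ 1) * (r ∸ 1)) ≤ t * (r ∸ 1) + 1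
2+[r∸2]+[t∸1][r∸1]≤t[r∸1]+1 (suc (suc r)) (suc t) _ _ = ≤-reflexive (+-comm 1 _)
2+[r∸2]+[t∸1][r∸1]≤t[r∸1]+1 1 _ (s≤s ()) _

1+[r∸2]+[t∸1][r∸1]≤t[r∸1] : ∀ r t → 2 ≤ r → 1 ≤ t → 1 + ((r ∸ 2) + (t ∸ 1) * (r ∸ 1)) ≤ t * (r ∸ 1)
1+[r∸2]+[t∸1][r∸1]≤t[r∸1] (suc (suc r)) (suc t) _ _ = ≤-refl
1+[r∸2]+[t∸1][r∸1]≤t[r∸1] 1 _ (s≤s ()) _

module Bounds {n r t : ℕ} (E : List (Edge n)) (edge-size : ∀ i → ∣ edge E i ∣ ≡ r) (linear : Linear E)
         (K₃ₜ-free : BergeK3tFree E t) (2≤r : 2 ≤ r) (1≤t : 1 ≤ t) where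

  open ≤-Reasoning

  N₁-bound : ∀ {u w v} → Adjacent E u w → v ∈ Ncommon E u w →
    sumRange 2 r (λ i → eCount E i v (Ncommon E u w)) ≤ t * (r ∸ 1) + 1
  N₁-bound {v = v} adj v∈U with adjacent⇒edge E adj | ∈Ncommon⇒≢ E v∈U
  ... | u≢w , l , u∈l , w∈l | v≢u , v≢w = begin
    sumRange 2 r (λ i → eCount E i v U)  ≤⟨ sumRange≤|R| 2 r (λ _ → 2≤∣S∣⇒Other v) ⟩
    length R                             ≤⟨ |R|≤ |Rᵘʷ|≤2 |Rˡ|≤r∸2 ⟩
    2 + ((r ∸ 2) + (t ∸ 1) * (r ∸ 1))    ≤⟨ 2+[r∸2]+[t∸1][r∸1]≤t[r∸1]+1 r t 2≤r 1≤t ⟩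
    t * (r ∸ 1) + 1                      ∎
    where open Local E edge-size linear K₃ₜ-free u≢w l u∈l w∈l v≢u v≢w

  N₂-bound : ∀ {u w v} → Adjacent E u w → InN2 E u w v →
    sumRange 1 (r ∸ 1) (λ i → eCount E i v (Ncommon E u w)) ≤ t * (r ∸ 1)
  N₂-bound {u} {w} {v} adj (v∈Nu , v∉Nw , v≢w) with adjacent⇒edge E adj | adjacent⇒edge E (∈Nbhd⁻ E v∈Nu)
  ... | u≢w , l , u∈l , w∈l | u≢v , _ = begin
    sumRange 1 (r ∸ 1) (λ i → eCount E i v U)  ≤⟨ sumRange≤|R| 1 (r ∸ 1) (λ _ → v∉S∧1≤∣S∣⇒Other v∉e∩U) ⟩
    length R                                   ≤⟨ |R|≤ (v∉Nw⇒|Rᵘʷ|≤1 v∉Nw) |Rˡ|≤r∸2 ⟩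
    1 + ((r ∸ 2) + (t ∸ 1) * (r ∸ 1))          ≤⟨ 1+[r∸2]+[t∸1][r∸1]≤t[r∸1] r t 2≤r 1≤t ⟩
    t * (r ∸ 1)                                ∎
    where
    open Local E edge-size linear K₃ₜ-free u≢w l u∈l w∈l (u≢v ∘ sym) v≢w
    v∉e∩U : ∀ {e} → v ∉ e ∩ U
    v∉e∩U v∈e∩U = v∉Nw (proj₂ (x∈p∩q⁻ (Nbhd E u) (Nbhd E w) (proj₂ (x∈p∩q⁻ _ U v∈e∩U))))

  l-bound : ∀ {u w v} → u ≢ w → InL E u w v → v ≢ u → v ≢ w →
    sumRange 2 r (λ i → eCount E i v (Ncommon E u w)) ≤ (t ∸ 1) * (r ∸ 1) + 1
  l-bound {v = v} u≢w (l , u∈l , w∈l , v∈l) v≢u v≢w = begin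
    sumRange 2 r (λ i → eCount E i v U)  ≤⟨ sumRange≤|R| 2 r (λ _ → 2≤∣S∣⇒Other v) ⟩
    length R                             ≤⟨ |R|≤ (v∈l⇒|Rᵘʷ|≤1 v∈l) (≤-reflexive (v∈l⇒|Rˡ|≡0 v∈l)) ⟩
    1 + (0 + (t ∸ 1) * (r ∸ 1))          ≡⟨ +-comm 1 _ ⟩
    (t ∸ 1) * (r ∸ 1) + 1                ∎
    where open Local E edge-size linear K₃ₜ-free u≢w l u∈l w∈l v≢u v≢w

lemma3p2 : (n r t : ℕ) → r ≤ n → 3 ≤ r → 3 ≤ t →
    (E : List (Edge n)) → IsRGraph E r → Linear E → Connected E → BergeK3tFree E t →
    (u w : Fin n) → Adjacent E u w →
    ((v : Fin n) → InN1 E u w v →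
      sumRange 2 r (λ i → eCount E i v (Ncommon E u w)) ≤ t * (r ∸ 1) + 1) ×
    ((v : Fin n) → InN2 E u w v →
      sumRange 1 (r ∸ 1) (λ i → eCount E i v (Ncommon E u w)) ≤ t * (r ∸ 1)) ×
    ((v : Fin n) → InL E u w v → v ≢ u → v ≢ w →
      sumRange 2 r (λ i → eCount E i v (Ncommon E u w)) ≤ (t ∸ 1) * (r ∸ 1) + 1)
lemma3p2 n r t _ 3≤r 3≤t E (_ , edge-size) linear _ K₃ₜ-free u w adj =
    (λ _ (v∈U , _) → N₁-bound adj v∈U)
  , (λ _ → N₂-bound adj)
  , (λ _ → l-bound (proj₁ (adjacent⇒edge E adj)))
  where open Bounds E edge-size linear K₃ₜ-free (≤-trans (n≤1+n 2) 3≤r) (≤-trans (s≤s z≤n) 3≤t)
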